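{- Let $G=(V,E)$ be a regular isoperimetric graph with optimal order $\mathcal O_G$, and let $\mathcal O'_G$ be the reverse order, $\mathcal O'_G(v)=|V|+1-\mathcal O_G(v)$. Then $\mathcal O'_G$ is optimal and the standard monotonic partition $\mathfrak M_G$ is regular.
   Context: For a finite simple graph $G=(V,E)$, $I_G(A)$ is the set of edges with both ends in $A$, $I_G(m)=\max_{|S|=m}|I_G(S)|$. A total order is a bijection $\mathcal O:V\to\{1,\dots,|V|\}$, $\mathcal O[a,b]=\mathcal O^{ -1}(\{a,\dots,b\})$; it is optimal if $|I_G(\mathcal O[1,k])|=I_G(k)$ for all $k$; $G$ is isoperimetric if it has one. $\delta_G(1)=0$, $\delta_G(m)=I_G(m)-I_G(m-1)$ for $m\ge2$. The standard monotonic partition $\mathfrak M_G$ (with respect to $\mathcal O_G$) partitions $V$ into the sets $\mathcal O_G[a,b]$ where $[a,b]$ ranges over the maximal intervals of $\{1,\dots,|V|\}$ such that $\delta_G(i+1)-\delta_G(i)=1$ for all $a\le i<b$. A partition of $V$ into consecutive intervals of $\mathcal O_G$ is regular if the $\delta$-sequence of the subgraph induced by the first part (with the restricted order) equals the $\delta$-sequence of the subgraph induced by the last part. -}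

module Defs where

open import Data.Bool using (Bool; true; false; _∧_; if_then_else_)
open import Data.Nat using (ℕ; zero; suc; _+_; _∸_; _≤_; _<ᵇ_; _≤ᵇ_; _⊔_; _≡ᵇ_)
open import Data.Fin using (Fin; toℕ)
open import Data.Fin.Subset using (Subset; ∣_∣; _⊆_)
open import Data.Fin.Permutation using (Permutation′; _⟨$⟩ʳ_; _∘ₚ_; reverse)
open import Data.List using (List; []; _∷_; map; filter; concatMap; allFin; upTo; zip; _++_; head; last)
open import Data.Vec using (Vec; []; _∷_; lookup; tabulate)
open import Data.Maybe using (Maybe; just)
open import Data.Product using (_×_; _,_; ∃)
open import Data.Unit using (⊤)
open import Relation.Binary.PropositionalEquality using (_≡_)
open import Relation.Nullary using (¬_)
open import Relation.Nullary.Decidable using (does; ¬?)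
open import Data.Nat.Properties using (_≟_)
open import Data.Nat.ListAction using (sum)

record Graph (n : ℕ) : Set where
  field
    adj    : Fin n → Fin n → Bool
    sym    : ∀ i j → adj i j ≡ adj j i
    irrefl : ∀ i → adj i i ≡ false
open Graph public

bit : Bool → ℕ
bit true  = 1
bit false = 0

degree : ∀ {n} → Graph n → Fin n → ℕ
degree {n} G v = sum (map (λ u → bit (adj G v u)) (allFin n))

IsRegular : ∀ {n} → Graph n → Set
IsRegular {n} G = ∃ λ k → ∀ (v : Fin n) → degree G v ≡ k

-- |I_G(A)|: number of edges with both ends in A (each edge counted once,
-- as the unordered pair {i,j} with toℕ i < toℕ j)
edgesIn : ∀ {n} → Graph n → Subset n → ℕ
edgesIn {n} G A =
  sum (map (λ i → sum (map (λ j →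
    bit ((toℕ i <ᵇ toℕ j) ∧ lookup A i ∧ lookup A j ∧ adj G i j)) (allFin n))) (allFin n))

allSubsets : ∀ n → List (Subset n)
allSubsets zero    = [] ∷ []
allSubsets (suc n) = concatMap (λ s → (false ∷ s) ∷ (true ∷ s) ∷ []) (allSubsets n)

maximum : List ℕ → ℕ
maximum []       = 0
maximum (x ∷ xs) = x ⊔ maximum xs

I : ∀ {n} → Graph n → ℕ → ℕ
I {n} G m = maximum (map (edgesIn G) (filter (λ S → ∣ S ∣ ≟ m) (allSubsets n)))

-- δ_G(1) = 0, δ_G(m) = I_G(m) - I_G(m-1) for m ≥ 2  (δ_G(0) := 0, unused)
δ : ∀ {n} → Graph n → ℕ → ℕ
δ G zero          = 0
δ G (suc zero)    = 0
δ G (suc (suc m)) = I G (suc (suc m)) ∸ I G (suc m)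

-- Total orders: bijections V → {1..|V|}, represented 0-based as
-- permutations of Fin n (vertex v has position toℕ (O ⟨$⟩ʳ v) + 1).
Order : ℕ → Set
Order n = Permutation′ n

-- O[a,b] = O⁻¹({a,...,b})  (1-based a, b)
seg : ∀ {n} → Order n → ℕ → ℕ → Subset n
seg O a b = tabulate (λ v → (a ≤ᵇ suc (toℕ (O ⟨$⟩ʳ v))) ∧ (suc (toℕ (O ⟨$⟩ʳ v)) ≤ᵇ b))

Optimal : ∀ {n} → Graph n → Order n → Set
Optimal {n} G O = ∀ k → k ≤ n → edgesIn G (seg O 1 k) ≡ I G k

-- reverse order O'(v) = |V| + 1 - O(v)   (0-based: opposite)
reverseOrder : ∀ {n} → Order n → Order n
reverseOrder O = O ∘ₚ reverse

-- δ-sequence of the subgraph H induced by A ⊆ V: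
-- I_H(m) = max over S ⊆ A with |S| = m of |I_G(S)|;
-- δseq = (δ_H(1), ..., δ_H(|A|)).
Iind : ∀ {n} → Graph n → Subset n → ℕ → ℕ
Iind {n} G A m =
  maximum (map (edgesIn G)
    (filter (λ S → ∣ S ∣ ≟ m) (filter (λ S → Data.Fin.Subset.Properties._⊆?_ S A) (allSubsets n))))
  where import Data.Fin.Subset.Properties

δind : ∀ {n} → Graph n → Subset n → ℕ → ℕ
δind G A zero          = 0
δind G A (suc zero)    = 0
δind G A (suc (suc m)) = Iind G A (suc (suc m)) ∸ Iind G A (suc m)

δseq : ∀ {n} → Graph n → Subset n → List ℕ
δseq G A = map (λ i → δind G A (suc i)) (upTo ∣ A ∣)

-- Standard monotonic partition (as 1-based intervals [a,b]) of {1..N}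
-- determined by the δ-function d: cut between i and i+1 (1 ≤ i < N)
-- exactly when d(i+1) - d(i) ≠ 1, i.e. d(i+1) ≠ d(i) + 1.
cuts : ℕ → (ℕ → ℕ) → List ℕ
cuts N d = filter (λ i → ¬? (d (suc i) ≟ suc (d i))) (map suc (upTo (N ∸ 1)))

monoIntervals : ℕ → (ℕ → ℕ) → List (ℕ × ℕ)
monoIntervals zero    d = []
monoIntervals (suc N) d = zip (1 ∷ map suc cs) (cs ++ (suc N ∷ []))
  where cs = cuts (suc N) d

standardMonotonicPartition : ∀ {n} → Graph n → Order n → List (Subset n)
standardMonotonicPartition {n} G O =
  map (λ { (a , b) → seg O a b }) (monoIntervals n (δ G))

RegularPartition : ∀ {n} → Graph n → List (Subset n) → Set
RegularPartition G P = ∀ F L → head P ≡ just F → last P ≡ just L → δseq G F ≡ δseq G L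

-- In a k-regular graph every vertex set A satisfies 2|I(A)| + k|V∖A| = 2|I(V∖A)| + k|A|:
-- both sides equal 2|I(A)| + 2|I(V∖A)| plus the number of edges between A and V∖A.
-- Comparing an arbitrary m-set with the complement of an optimal (n-m)-set shows that
-- the last m vertices of an optimal order span I(m) edges, so the reverse order is
-- optimal, and initial segments give 2 I(a) + k b = 2 I(b) + k a whenever a + b = n.
-- The linear terms have no second difference, so the second differences of I, and with
-- them the places where δ fails to grow by exactly one, are symmetric under x ↦ n - x.
-- Hence the first and the last part of the standard monotonic partition have the same
-- size c, and as initial segments of the optimal orders O and reverse O both have the
-- δ-sequence (δ(1), ..., δ(c)).
module Submission where

open import Data.Bool using (Bool; true; false; _∧_; not; T)
open import Data.Bool.Properties using (T-∧; T-≡; ∧-identityʳ; ∧-zeroʳ)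
open import Data.Empty using (⊥-elim)
open import Data.Fin as Fin using (Fin; toℕ; opposite)
open import Data.Fin.Permutation using (_⟨$⟩ʳ_; _⟨$⟩ˡ_; inverseˡ)
open import Data.Fin.Properties using (toℕ<n; toℕ-injective; opposite-prop)
open import Data.Fin.Subset using (Subset; ∣_∣; ∁; _⊆_)
open import Data.Fin.Subset.Properties using (∣∁p∣≡n∸∣p∣; _⊆?_)
open import Data.List using (List; []; _∷_; map; filter; tabulate; head; last; zip; _++_; upTo)
open import Data.List.Membership.Propositional using (_∈_)
open import Data.List.Membership.Propositional.Properties
  using (∈-filter⁺; ∈-filter⁻; ∈-map⁺; ∈-map⁻; ∈-upTo⁺; ∈-upTo⁻; ∈-concatMap⁺)
open import Data.List.Properties using (head-map; last-map; map-cong-local)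
import Data.List.Relation.Unary.All as All
import Data.List.Relation.Unary.All.Properties as All
import Data.List.Relation.Unary.Any as Any
open import Data.List.Relation.Unary.Any using (here; there)
open import Data.List.Relation.Unary.AllPairs using (AllPairs; _∷_)
import Data.List.Relation.Unary.AllPairs.Properties as AllPairs
import Data.Maybe as Maybe
open import Data.Maybe using (just; fromMaybe)
open import Data.Maybe.Properties using (just-injective)
open import Data.Nat using (ℕ; zero; suc; _+_; _*_; _∸_; _≤_; _<_; _<ᵇ_; z≤n; s≤s)
open import Data.Nat.Properties
import Data.Nat.ListAction as ListAction
open import Data.Nat.Tactic.RingSolver using (solve)
open import Data.Product using (_×_; _,_; proj₁; proj₂; ∃₂)
open import Data.Vec using (lookup)
import Data.Vec.Properties as Vec
open import Function using (_∘_; id; case_of_; _⇔_; mk⇔; Equivalence)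
open import Relation.Binary.PropositionalEquality
open import Relation.Nullary using (¬_; ¬?)

open import Algebra.Properties.Semiring.Sum +-*-semiring
  using (sum-syntax; sum-cong-≗; sum-replicate-zero; ∑-distrib-+; ∑-comm; ∑-permute;
         *-distribˡ-sum; *-distribʳ-sum)

open import Defs hiding (sym)

open Equivalence using (to; from)

private
  variable
    n : ℕ

m+m≤n+n⇒m≤n : ∀ {a b} → a + a ≤ b + b → a ≤ b
m+m≤n+n⇒m≤n le = ≮⇒≥ (λ b<a → <⇒≱ (+-mono-< b<a b<a) le)

m+m≡n+n⇒m≡n : ∀ {a b} → a + a ≡ b + b → a ≡ b
m+m≡n+n⇒m≡n eq = ≤-antisym (m+m≤n+n⇒m≤n (≤-reflexive eq)) (m+m≤n+n⇒m≤n (≤-reflexive (sym eq)))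

∸-step⇔ : ∀ {a b c} → a ≤ b → b ≤ c → (c ∸ b ≡ suc (b ∸ a)) ⇔ (c + a ≡ suc (b + b))
∸-step⇔ {a} {b} {c} a≤b b≤c =
  mk⇔ (λ e → trans c+a (trans (cong (_+ (b + a)) e) (sym 1+b+b)))
      (λ e → +-cancelʳ-≡ (b + a) _ _ (trans (sym c+a) (trans e 1+b+b)))
  where
  c+a : c + a ≡ (c ∸ b) + (b + a)
  c+a = trans (cong (_+ a) (sym (m∸n+n≡m b≤c))) (+-assoc (c ∸ b) b a)
  1+b+b : suc (b + b) ≡ suc (b ∸ a) + (b + a)
  1+b+b = cong suc (begin
    b + b             ≡⟨ cong (_+ b) (sym (m∸n+n≡m a≤b)) ⟩
    (b ∸ a) + a + b   ≡⟨ +-assoc (b ∸ a) a b ⟩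
    (b ∸ a) + (a + b) ≡⟨ cong ((b ∸ a) +_) (+-comm a b) ⟩
    (b ∸ a) + (b + a) ∎)
    where open ≡-Reasoning

<-transfer : ∀ {q s r m} → q + s ≡ r + m → q < m → r < s
<-transfer {q} {s} {r} {m} eq q<m = +-cancelʳ-< m r s (begin-strict
  r + m ≡⟨ sym eq ⟩
  q + s <⟨ +-monoˡ-< s q<m ⟩
  m + s ≡⟨ +-comm m s ⟩
  s + m ∎)
  where open ≤-Reasoning

T-injective : ∀ {a b} → (T a ⇔ T b) → a ≡ b
T-injective {false} {false} _   = refl
T-injective {false} {true}  a⇔b = ⊥-elim (from a⇔b _)
T-injective {true}  {false} a⇔b = ⊥-elim (to a⇔b _)
T-injective {true}  {true}  _   = refl

<ᵇ-transfer : ∀ {q s r m} → q + s ≡ r + m → (q <ᵇ m) ≡ (r <ᵇ s)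
<ᵇ-transfer {q} {s} {r} {m} eq = T-injective (mk⇔
  (λ t → <⇒<ᵇ (<-transfer {q} {s} {r} {m} eq (<ᵇ⇒< q m t)))
  (λ t → <⇒<ᵇ (<-transfer {r} {m} {q} {s} (sym eq) (<ᵇ⇒< r s t))))

<ᵇ-suc≡not-<ᵇ : ∀ c p → (c <ᵇ suc p) ≡ not (p <ᵇ c)
<ᵇ-suc≡not-<ᵇ zero    p       = refl
<ᵇ-suc≡not-<ᵇ (suc c) zero    = refl
<ᵇ-suc≡not-<ᵇ (suc c) (suc p) = <ᵇ-suc≡not-<ᵇ c p

∧-swapˡ : ∀ x y z → x ∧ y ∧ z ≡ y ∧ x ∧ z
∧-swapˡ true  true  z = refl
∧-swapˡ true  false z = refl
∧-swapˡ false true  z = refl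
∧-swapˡ false false z = refl

∧∧-mono : ∀ {x y x′ y′ z} → (T x → T x′) → (T y → T y′) → T (x ∧ y ∧ z) → T (x′ ∧ y′ ∧ z)
∧∧-mono hx hy t with to T-∧ t
... | tx , tyz with to T-∧ tyz
... | ty , tz = from T-∧ (hx tx , from T-∧ (hy ty , tz))

bit-mono : ∀ {a b} → (T a → T b) → bit a ≤ bit b
bit-mono {false}          _ = z≤n
bit-mono {true}  {true}   _ = ≤-refl
bit-mono {true}  {false}  h = ⊥-elim (h _)

bit-split : ∀ x y z → bit (x ∧ y ∧ z) + bit (x ∧ not y ∧ z) ≡ bit x * bit z
bit-split true  true  z = refl
bit-split true  false z = sym (+-identityʳ (bit z))
bit-split false y     z = refl

sum-map-tabulate : ∀ {A : Set} (f : A → ℕ) (g : Fin n → A) →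
  ListAction.sum (map f (tabulate g)) ≡ ∑[ i < n ] f (g i)
sum-map-tabulate {zero}  f g = refl
sum-map-tabulate {suc n} f g = cong (f (g Fin.zero) +_) (sum-map-tabulate f (g ∘ Fin.suc))

∑-mono-≤ : ∀ {f g : Fin n → ℕ} → (∀ i → f i ≤ g i) → ∑[ i < n ] f i ≤ ∑[ i < n ] g i
∑-mono-≤ {zero}  _   = z≤n
∑-mono-≤ {suc n} f≤g = +-mono-≤ (f≤g Fin.zero) (∑-mono-≤ (f≤g ∘ Fin.suc))

∑∑-distrib-+ : ∀ (f g : Fin n → Fin n → ℕ) →
  ∑[ i < n ] ∑[ j < n ] (f i j + g i j) ≡ ∑[ i < n ] ∑[ j < n ] f i j + ∑[ i < n ] ∑[ j < n ] g i j
∑∑-distrib-+ {n} f g = trans (sum-cong-≗ (λ i → ∑-distrib-+ (f i) (g i)))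
                             (∑-distrib-+ (λ i → ∑[ j < n ] f i j) (λ i → ∑[ j < n ] g i j))

∑∑-zero : ∀ {f : Fin n → Fin n → ℕ} → (∀ i j → f i j ≡ 0) → ∑[ i < n ] ∑[ j < n ] f i j ≡ 0
∑∑-zero {n} f≡0 =
  trans (sum-cong-≗ (λ i → trans (sum-cong-≗ (f≡0 i)) (sum-replicate-zero n))) (sum-replicate-zero n)

∑-<ᵇ : ∀ {b} → b ≤ n → ∑[ u < n ] bit (toℕ u <ᵇ b) ≡ b
∑-<ᵇ {zero}  {zero}  _         = refl
∑-<ᵇ {suc n} {zero}  _         = sum-replicate-zero (suc n)
∑-<ᵇ {suc n} {suc b} (s≤s b≤n) = cong suc (∑-<ᵇ b≤n)

∣∣-∑ : (A : Subset n) → ∣ A ∣ ≡ ∑[ i < n ] bit (lookup A i)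
∣∣-∑ Data.Vec.[]            = refl
∣∣-∑ (true  Data.Vec.∷ A) = cong suc (∣∣-∑ A)
∣∣-∑ (false Data.Vec.∷ A) = ∣∣-∑ A

⊆⇒T-lookup : ∀ {A B : Subset n} → A ⊆ B → ∀ v → T (lookup A v) → T (lookup B v)
⊆⇒T-lookup A⊆B v t =
  from T-≡ (Vec.[]=⇒lookup (A⊆B (Vec.lookup⇒[]= v _ (to T-≡ t))))

T-lookup⇒⊆ : ∀ {A B : Subset n} → (∀ v → T (lookup A v) → T (lookup B v)) → A ⊆ B
T-lookup⇒⊆ h {v} v∈A =
  Vec.lookup⇒[]= v _ (to T-≡ (h v (from T-≡ (Vec.[]=⇒lookup v∈A))))

-- Counting edges

module _ {n} (G : Graph n) where

  degree-∑ : ∀ v → degree G v ≡ ∑[ u < n ] bit (adj G v u)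
  degree-∑ v = sum-map-tabulate {n = n} _ id

  edgesIn-∑ : ∀ A → edgesIn G A ≡
    ∑[ i < n ] ∑[ j < n ] bit ((toℕ i <ᵇ toℕ j) ∧ lookup A i ∧ lookup A j ∧ adj G i j)
  edgesIn-∑ A = trans (sum-map-tabulate {n = n} _ id) (sum-cong-≗ {n} (λ i → sum-map-tabulate {n = n} _ id))

  arcs : Subset n → Subset n → ℕ
  arcs X Y = ∑[ i < n ] ∑[ j < n ] bit (lookup X i ∧ lookup Y j ∧ adj G i j)

  arcs-sym : ∀ X Y → arcs X Y ≡ arcs Y X
  arcs-sym X Y = trans (∑-comm (λ i j → bit (lookup X i ∧ lookup Y j ∧ adj G i j)))
    (sum-cong-≗ λ j → sum-cong-≗ λ i → cong bit (trans (∧-swapˡ (lookup X i) (lookup Y j) _)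
                    (cong (λ a → lookup Y j ∧ lookup X i ∧ a) (Graph.sym G i j))))

  -- Each unordered edge {i, j} inside A is counted once as (i , j) and once as (j , i).
  arc-as-edges : ∀ i j (x y : Bool) → bit (x ∧ y ∧ adj G i j) ≡
    bit ((toℕ i <ᵇ toℕ j) ∧ x ∧ y ∧ adj G i j) + bit ((toℕ j <ᵇ toℕ i) ∧ y ∧ x ∧ adj G j i)
  arc-as-edges i j x y with toℕ i <ᵇ toℕ j in i<j | toℕ j <ᵇ toℕ i in j<i
  ... | true  | true  =
    ⊥-elim (<-asym (<ᵇ⇒< (toℕ i) (toℕ j) (from T-≡ i<j)) (<ᵇ⇒< (toℕ j) (toℕ i) (from T-≡ j<i)))
  ... | true  | false = sym (+-identityʳ _)
  ... | false | true  =
    cong bit (trans (∧-swapˡ x y _) (cong (λ a → y ∧ x ∧ a) (Graph.sym G i j)))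
  ... | false | false = cong bit (begin
    x ∧ y ∧ adj G i j ≡⟨ cong (λ a → x ∧ y ∧ a) (trans (cong (adj G i) (sym i≡j))
                                                         (Graph.irrefl G i)) ⟩
    x ∧ y ∧ false     ≡⟨ cong (x ∧_) (∧-zeroʳ y) ⟩
    x ∧ false         ≡⟨ ∧-zeroʳ x ⟩
    false             ∎)
    where
    open ≡-Reasoning
    ≮ : ∀ {a b} → (a <ᵇ b) ≡ false → b ≤ a
    ≮ eq = ≮⇒≥ (λ lt → subst T eq (<⇒<ᵇ lt))
    i≡j : i ≡ j
    i≡j = toℕ-injective (≤-antisym (≮ j<i) (≮ i<j))

  arcs-diagonal : ∀ A → arcs A A ≡ edgesIn G A + edgesIn G A
  arcs-diagonal A = begin
    arcs A A
      ≡⟨ sum-cong-≗ (λ i → sum-cong-≗ (λ j → arc-as-edges i j (lookup A i) (lookup A j))) ⟩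
    ∑[ i < n ] ∑[ j < n ] (E i j + E j i)
      ≡⟨ ∑∑-distrib-+ E (λ i j → E j i) ⟩
    ∑[ i < n ] ∑[ j < n ] E i j + ∑[ i < n ] ∑[ j < n ] E j i
      ≡⟨ cong (edges +_) (∑-comm (λ i j → E j i)) ⟩
    ∑[ i < n ] ∑[ j < n ] E i j + ∑[ i < n ] ∑[ j < n ] E i j
      ≡⟨ sym (cong₂ _+_ (edgesIn-∑ A) (edgesIn-∑ A)) ⟩
    edgesIn G A + edgesIn G A ∎
    where
    open ≡-Reasoning
    E : Fin n → Fin n → ℕ
    E i j = bit ((toℕ i <ᵇ toℕ j) ∧ lookup A i ∧ lookup A j ∧ adj G i j)
    edges : ℕ
    edges = ∑[ i < n ] ∑[ j < n ] E i j

  arcs-split : ∀ X Y → arcs X Y + arcs X (∁ Y) ≡ ∑[ i < n ] (bit (lookup X i) * degree G i)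
  arcs-split X Y = begin
    arcs X Y + arcs X (∁ Y)
      ≡⟨ sym (∑∑-distrib-+ (λ i j → bit (x i ∧ lookup Y j ∧ a i j))
                           (λ i j → bit (x i ∧ lookup (∁ Y) j ∧ a i j))) ⟩
    ∑[ i < n ] ∑[ j < n ] (bit (x i ∧ lookup Y j ∧ a i j) + bit (x i ∧ lookup (∁ Y) j ∧ a i j))
      ≡⟨ sum-cong-≗ (λ i → sum-cong-≗ λ j →
           trans (cong (λ y → bit (x i ∧ lookup Y j ∧ a i j) + bit (x i ∧ y ∧ a i j))
                       (Vec.lookup-map j not Y))
                 (bit-split (x i) (lookup Y j) (a i j))) ⟩
    ∑[ i < n ] ∑[ j < n ] (bit (x i) * bit (a i j))
      ≡⟨ sum-cong-≗ (λ i → sym (*-distribˡ-sum (bit (x i)) (λ j → bit (a i j)))) ⟩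
    ∑[ i < n ] (bit (x i) * ∑[ j < n ] bit (a i j))
      ≡⟨ sum-cong-≗ (λ i → cong (bit (x i) *_) (sym (degree-∑ i))) ⟩
    ∑[ i < n ] (bit (x i) * degree G i) ∎
    where
    open ≡-Reasoning
    x : Fin n → Bool
    x = lookup X
    a : Fin n → Fin n → Bool
    a = adj G

  edgesIn-mono : ∀ {A B} → A ⊆ B → edgesIn G A ≤ edgesIn G B
  edgesIn-mono {A} {B} A⊆B = m+m≤n+n⇒m≤n (subst₂ _≤_ (arcs-diagonal A) (arcs-diagonal B)
    (∑-mono-≤ λ i → ∑-mono-≤ λ j → bit-mono (∧∧-mono (⊆⇒T-lookup A⊆B i) (⊆⇒T-lookup A⊆B j))))

  edgesIn-subsingleton : ∀ {A} → (∀ i j → T (lookup A i) → T (lookup A j) → i ≡ j) → edgesIn G A ≡ 0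
  edgesIn-subsingleton {A} single =
    m+n≡0⇒m≡0 (edgesIn G A) (trans (sym (arcs-diagonal A)) (∑∑-zero no-arc))
    where
    no-arc : ∀ i j → bit (lookup A i ∧ lookup A j ∧ adj G i j) ≡ 0
    no-arc i j with lookup A i in ai | lookup A j in aj
    ... | false | _     = refl
    ... | true  | false = refl
    ... | true  | true  =
      cong bit (trans (cong (adj G i) (sym (single i j (from T-≡ ai) (from T-≡ aj)))) (Graph.irrefl G i))

maximum-upper : ∀ {x xs} → x ∈ xs → x ≤ maximum xs
maximum-upper {xs = y ∷ ys} (here refl) = m≤m⊔n y (maximum ys)
maximum-upper {xs = y ∷ ys} (there x∈) = ≤-trans (maximum-upper x∈) (m≤n⊔m y (maximum ys))

maximum-least : ∀ {b} xs → (∀ {x} → x ∈ xs → x ≤ b) → maximum xs ≤ b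
maximum-least []       _ = z≤n
maximum-least (y ∷ ys) h = ⊔-lub (h (here refl)) (maximum-least ys (h ∘ there))

allSubsets-complete : (S : Subset n) → S ∈ allSubsets n
allSubsets-complete Data.Vec.[]      = here refl
allSubsets-complete (x Data.Vec.∷ S) = ∈-concatMap⁺ _ (Any.map (λ { refl → extend x }) (allSubsets-complete S))
  where
  extend : ∀ x → (x Data.Vec.∷ S) ∈ (false Data.Vec.∷ S) ∷ (true Data.Vec.∷ S) ∷ []
  extend false = here refl
  extend true  = there (here refl)

module _ {n} (G : Graph n) where

  edgesIn≤I : ∀ {S m} → ∣ S ∣ ≡ m → edgesIn G S ≤ I G m
  edgesIn≤I {S} {m} ∣S∣≡m = maximum-upper
    (∈-map⁺ (edgesIn G) (∈-filter⁺ (λ S → ∣ S ∣ ≟ m) (allSubsets-complete S) ∣S∣≡m))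

  I-least : ∀ {m b} → (∀ S → ∣ S ∣ ≡ m → edgesIn G S ≤ b) → I G m ≤ b
  I-least {m} h = maximum-least _ λ x∈ → case ∈-map⁻ (edgesIn G) x∈ of λ where
    (S , S∈ , refl) → h S (proj₂ (∈-filter⁻ (λ S → ∣ S ∣ ≟ m) {xs = allSubsets n} S∈))

  Iind≤I : ∀ A m → Iind G A m ≤ I G m
  Iind≤I A m = maximum-least _ λ x∈ → case ∈-map⁻ (edgesIn G) x∈ of λ where
    (S , S∈ , refl) → edgesIn≤I {S} (proj₂ (∈-filter⁻ (λ S → ∣ S ∣ ≟ m)
      {xs = filter (λ S → S ⊆? A) (allSubsets n)} S∈))

  edgesIn≤Iind : ∀ {A S m} → S ⊆ A → ∣ S ∣ ≡ m → edgesIn G S ≤ Iind G A m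
  edgesIn≤Iind {A} {S} {m} S⊆A ∣S∣≡m = maximum-upper (∈-map⁺ (edgesIn G)
    (∈-filter⁺ (λ S → ∣ S ∣ ≟ m) (∈-filter⁺ (λ S → S ⊆? A) (allSubsets-complete S) S⊆A) ∣S∣≡m))

-- Segments of a total order

⟨$⟩ʳ-injective : ∀ (O : Order n) {i j} → O ⟨$⟩ʳ i ≡ O ⟨$⟩ʳ j → i ≡ j
⟨$⟩ʳ-injective O eq = trans (sym (inverseˡ O)) (trans (cong (O ⟨$⟩ˡ_) eq) (inverseˡ O))

lookup-initial : ∀ (O : Order n) b v → lookup (seg O 1 b) v ≡ (toℕ (O ⟨$⟩ʳ v) <ᵇ b)
lookup-initial O b v = Vec.lookup∘tabulate _ v

initial-⊆ : ∀ (O : Order n) {m c} → m ≤ c → seg O 1 m ⊆ seg O 1 c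
initial-⊆ O {m} {c} m≤c = T-lookup⇒⊆ λ v t →
  subst T (sym (lookup-initial O c v))
    (<⇒<ᵇ (<-≤-trans (<ᵇ⇒< _ m (subst T (lookup-initial O m v) t)) m≤c))

∣initial∣ : ∀ (O : Order n) {b} → b ≤ n → ∣ seg O 1 b ∣ ≡ b
∣initial∣ {n} O {b} b≤n = begin
  ∣ seg O 1 b ∣                              ≡⟨ ∣∣-∑ (seg O 1 b) ⟩
  ∑[ v < n ] bit (lookup (seg O 1 b) v)      ≡⟨ sum-cong-≗ (cong bit ∘ lookup-initial O b) ⟩
  ∑[ v < n ] bit (toℕ (O ⟨$⟩ʳ v) <ᵇ b)       ≡⟨ sym (∑-permute (λ u → bit (toℕ u <ᵇ b)) O) ⟩
  ∑[ u < n ] bit (toℕ u <ᵇ b)                ≡⟨ ∑-<ᵇ b≤n ⟩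
  b                                          ∎
  where open ≡-Reasoning

initial-one-subsingleton : ∀ (O : Order n) i j →
  T (lookup (seg O 1 1) i) → T (lookup (seg O 1 1) j) → i ≡ j
initial-one-subsingleton O i j ti tj =
  ⟨$⟩ʳ-injective O (toℕ-injective (trans (first i ti) (sym (first j tj))))
  where
  first : ∀ v → T (lookup (seg O 1 1) v) → toℕ (O ⟨$⟩ʳ v) ≡ 0
  first v t = n<1⇒n≡0 (<ᵇ⇒< _ 1 (subst T (lookup-initial O 1 v) t))

opposite-<ᵇ : ∀ (i : Fin n) {m} → m ≤ n → (toℕ (opposite i) <ᵇ m) ≡ not (toℕ i <ᵇ n ∸ m)
opposite-<ᵇ {n} i {m} m≤n = begin
  toℕ (opposite i) <ᵇ m  ≡⟨ cong (_<ᵇ m) (opposite-prop i) ⟩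
  n ∸ suc (toℕ i) <ᵇ m   ≡⟨ <ᵇ-transfer {n ∸ suc (toℕ i)} {suc (toℕ i)} {n ∸ m} {m} both≡n ⟩
  n ∸ m <ᵇ suc (toℕ i)   ≡⟨ <ᵇ-suc≡not-<ᵇ (n ∸ m) (toℕ i) ⟩
  not (toℕ i <ᵇ n ∸ m)   ∎
  where
  open ≡-Reasoning
  both≡n : n ∸ suc (toℕ i) + suc (toℕ i) ≡ n ∸ m + m
  both≡n = trans (m∸n+n≡m (toℕ<n i)) (sym (m∸n+n≡m m≤n))

∁-tabulate : ∀ (f : Fin n → Bool) → ∁ (Data.Vec.tabulate f) ≡ Data.Vec.tabulate (not ∘ f)
∁-tabulate f = sym (Vec.tabulate-∘ not f)

reverse-initial : ∀ (O : Order n) {m} → m ≤ n → seg (reverseOrder O) 1 m ≡ ∁ (seg O 1 (n ∸ m))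
reverse-initial O m≤n =
  trans (Vec.tabulate-cong (λ v → opposite-<ᵇ (O ⟨$⟩ʳ v) m≤n)) (sym (∁-tabulate _))

final≡∁initial : ∀ (O : Order n) c → seg O (suc c) n ≡ ∁ (seg O 1 c)
final≡∁initial {n} O c = trans (Vec.tabulate-cong final) (sym (∁-tabulate _))
  where
  final : ∀ v → let p = toℕ (O ⟨$⟩ʳ v) in (c <ᵇ suc p) ∧ (p <ᵇ n) ≡ not (p <ᵇ c)
  final v = trans (cong ((c <ᵇ suc p) ∧_) (to T-≡ (<⇒<ᵇ (toℕ<n (O ⟨$⟩ʳ v)))))
                  (trans (∧-identityʳ _) (<ᵇ-suc≡not-<ᵇ c p))
    where p = toℕ (O ⟨$⟩ʳ v)

final≡reverse-initial : ∀ (O : Order n) {c} → c ≤ n → seg O (suc c) n ≡ seg (reverseOrder O) 1 (n ∸ c)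
final≡reverse-initial {n} O {c} c≤n = begin
  seg O (suc c) n                     ≡⟨ final≡∁initial O c ⟩
  ∁ (seg O 1 c)                       ≡⟨ cong (∁ ∘ seg O 1) (sym (m∸[m∸n]≡n c≤n)) ⟩
  ∁ (seg O 1 (n ∸ (n ∸ c)))           ≡⟨ sym (reverse-initial O (m∸n≤m n c)) ⟩
  seg (reverseOrder O) 1 (n ∸ c)      ∎
  where open ≡-Reasoning

-- Monotonic partitions

UnitStep : (ℕ → ℕ) → ℕ → Set
UnitStep d x = d (suc x) ≡ suc (d x)

UnitSecondDifference : (ℕ → ℕ) → ℕ → Set
UnitSecondDifference f y = f (suc (suc y)) + f y ≡ suc (f (suc y) + f (suc y))

-- a, b, c and a′, b′, c′ stand for f at y, y+1, y+2 and at z, z+1, z+2.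
second-difference-transfer : ∀ a b c a′ b′ c′ y z k →
  c + c + z * k ≡ a′ + a′ + suc (suc y) * k →
  a + a + suc (suc z) * k ≡ c′ + c′ + y * k →
  b + b + suc z * k ≡ b′ + b′ + suc y * k →
  c + a ≡ suc (b + b) → c′ + a′ ≡ suc (b′ + b′)
second-difference-transfer a b c a′ b′ c′ y z k e₁ e₂ e₃ e =
  m+m≡n+n⇒m≡n (+-cancelʳ-≡ ((2 + y) * k + y * k) _ _ (begin
    (c′ + a′) + (c′ + a′) + ((2 + y) * k + y * k)
      ≡⟨ solve (a′ ∷ c′ ∷ y ∷ k ∷ []) ⟩
    (c′ + c′ + y * k) + (a′ + a′ + (2 + y) * k)
      ≡⟨ cong₂ _+_ (sym e₂) (sym e₁) ⟩
    (a + a + (2 + z) * k) + (c + c + z * k)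
      ≡⟨ solve (a ∷ c ∷ z ∷ k ∷ []) ⟩
    (c + a) + (c + a) + ((2 + z) * k + z * k)
      ≡⟨ cong (λ t → t + t + ((2 + z) * k + z * k)) e ⟩
    (1 + (b + b)) + (1 + (b + b)) + ((2 + z) * k + z * k)
      ≡⟨ solve (b ∷ z ∷ k ∷ []) ⟩
    2 + ((b + b + (1 + z) * k) + (b + b + (1 + z) * k))
      ≡⟨ cong (λ t → 2 + (t + t)) e₃ ⟩
    2 + ((b′ + b′ + (1 + y) * k) + (b′ + b′ + (1 + y) * k))
      ≡⟨ solve (b′ ∷ y ∷ k ∷ []) ⟩
    (1 + (b′ + b′)) + (1 + (b′ + b′)) + ((2 + y) * k + y * k) ∎))
  where open ≡-Reasoning

-- 2 f(a) - k a is invariant under a ↦ N - a, so the second differences of f are too.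
unitSecondDifference-reflect : ∀ (f : ℕ → ℕ) {k N} →
  (∀ {a b} → a + b ≡ N → f a + f a + b * k ≡ f b + f b + a * k) →
  ∀ {y z} → y + suc (suc z) ≡ N → UnitSecondDifference f y → UnitSecondDifference f z
unitSecondDifference-reflect f {k} reflect {y} {z} eq =
  second-difference-transfer (f y) (f (suc y)) (f (suc (suc y))) (f z) (f (suc z)) (f (suc (suc z))) y z k
    (reflect ends) (reflect eq) (reflect middle)
  where
  ends : suc (suc y) + z ≡ _
  ends = trans (sym (trans (+-suc y (suc z)) (cong suc (+-suc y z)))) eq
  middle : suc y + suc z ≡ _
  middle = trans (cong suc (+-suc y z)) ends

∈-cuts⁻ : ∀ {N d x} → x ∈ cuts N d → ∃₂ λ y z → x ≡ suc y × suc y + suc z ≡ N × ¬ UnitStep d x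
∈-cuts⁻ {N} {d} x∈ with ∈-filter⁻ (λ i → ¬? (d (suc i) ≟ suc (d i))) {xs = map suc (upTo (N ∸ 1))} x∈
... | x∈′ , ¬step with ∈-map⁻ suc x∈′
... | y , y∈ , refl =
  y , N ∸ suc (suc y) , refl , trans (+-suc (suc y) _) (m+[n∸m]≡n (bound N (∈-upTo⁻ y∈))) , ¬step
  where
  bound : ∀ N → y < N ∸ 1 → suc (suc y) ≤ N
  bound (suc N) y<N = s≤s y<N

∈-cuts⁺ : ∀ {N d y z} → suc y + suc z ≡ N → ¬ UnitStep d (suc y) → suc y ∈ cuts N d
∈-cuts⁺ {d = d} {y} {z} refl ¬step = ∈-filter⁺ (λ i → ¬? (d (suc i) ≟ suc (d i)))
  (∈-map⁺ suc (∈-upTo⁺ (m<m+n y (s≤s z≤n)))) ¬step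

cuts-sorted : ∀ N d → AllPairs _<_ (cuts N d)
cuts-sorted N d = AllPairs.filter⁺ (λ i → ¬? (d (suc i) ≟ suc (d i)))
  (AllPairs.map⁺ (AllPairs.applyUpTo⁺₁ id (N ∸ 1) (λ i<j _ → s≤s i<j)))

lastOr : ℕ → List ℕ → ℕ
lastOr a []       = a
lastOr _ (c ∷ cs) = lastOr c cs

lastOr-∈ : ∀ c cs → lastOr c cs ∈ c ∷ cs
lastOr-∈ c []       = here refl
lastOr-∈ c (d ∷ ds) = there (lastOr-∈ d ds)

head-≤ : ∀ {c cs x} → AllPairs _<_ (c ∷ cs) → x ∈ c ∷ cs → c ≤ x
head-≤ _          (here refl) = ≤-refl
head-≤ (c<cs ∷ _) (there x∈)  = <⇒≤ (All.lookup c<cs x∈)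

≤-lastOr : ∀ {c cs x} → AllPairs _<_ (c ∷ cs) → x ∈ c ∷ cs → x ≤ lastOr c cs
≤-lastOr {cs = []}    _                          (here refl) = ≤-refl
≤-lastOr {cs = _ ∷ _} ((c<d All.∷ _) ∷ sorted) (here refl) =
  <⇒≤ (<-≤-trans c<d (≤-lastOr sorted (here refl)))
≤-lastOr {cs = _ ∷ _} (_ ∷ sorted)               (there x∈)  = ≤-lastOr sorted x∈

first+last≡ : ∀ {N} cs → AllPairs _<_ cs → (∀ {x} → x ∈ cs → x ≤ N × N ∸ x ∈ cs) →
  fromMaybe N (head cs) + lastOr 0 cs ≡ N
first+last≡         []       _      _      = +-identityʳ _
first+last≡ {N} (c ∷ cs) sorted closed = ≤-antisym upper lower
  where
  l = lastOr c cs
  l∈ = lastOr-∈ c cs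
  upper : c + l ≤ N
  upper = m≤o∸n⇒m+n≤o c (proj₁ (closed l∈)) (head-≤ sorted (proj₂ (closed l∈)))
  lower : N ≤ c + l
  lower = begin
    N           ≡⟨ sym (m∸n+n≡m (proj₁ (closed (here refl)))) ⟩
    (N ∸ c) + c ≤⟨ +-monoˡ-≤ c (≤-lastOr sorted (proj₂ (closed (here refl)))) ⟩
    l + c       ≡⟨ +-comm l c ⟩
    c + l       ∎
    where open ≤-Reasoning

zip-head : ∀ {N} cs → head (zip (1 ∷ map suc cs) (cs ++ N ∷ [])) ≡ just (1 , fromMaybe N (head cs))
zip-head []      = refl
zip-head (c ∷ _) = refl

zip-last : ∀ {N} a cs → last (zip (suc a ∷ map suc cs) (cs ++ N ∷ [])) ≡ just (suc (lastOr a cs) , N)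
zip-last a []           = refl
zip-last a (c ∷ [])     = refl
zip-last a (c ∷ d ∷ cs) = zip-last c (d ∷ cs)

head-standardMonotonicPartition : ∀ {n} (G : Graph n) O {F} →
  head (standardMonotonicPartition G O) ≡ just F → F ≡ seg O 1 (fromMaybe n (head (cuts n (δ G))))
head-standardMonotonicPartition {zero}  G O ()
head-standardMonotonicPartition {suc N} G O hd =
  just-injective (trans (sym hd)
    (trans (head-map _) (cong (Maybe.map _) (zip-head {suc N} (cuts (suc N) (δ G))))))

last-standardMonotonicPartition : ∀ {n} (G : Graph n) O {L} →
  last (standardMonotonicPartition G O) ≡ just L → L ≡ seg O (suc (lastOr 0 (cuts n (δ G)))) n
last-standardMonotonicPartition {zero}  G O ()
last-standardMonotonicPartition {suc N} G O lst =
  just-injective (trans (sym lst)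
    (trans (last-map _ (monoIntervals (suc N) (δ G)))
           (cong (Maybe.map _) (zip-last {suc N} 0 (cuts (suc N) (δ G))))))

module _ {n} (G : Graph n) where

  δ-difference : I G 1 ≡ 0 → ∀ y → δ G (suc y) ≡ I G (suc y) ∸ I G y
  δ-difference I₁≡0 zero    = sym (trans (cong (_∸ I G 0) I₁≡0) (0∸n≡0 (I G 0)))
  δ-difference _    (suc y) = refl

  δseq-initial : ∀ {O c} → Optimal G O → c ≤ n → δseq G (seg O 1 c) ≡ map (δ G ∘ suc) (upTo c)
  δseq-initial {O} {c} optimal c≤n = begin
    map (λ i → δind G A (suc i)) (upTo ∣ A ∣)
      ≡⟨ cong (map (λ i → δind G A (suc i)) ∘ upTo) (∣initial∣ O c≤n) ⟩
    map (λ i → δind G A (suc i)) (upTo c)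
      ≡⟨ map-cong-local (All.applyUpTo⁺₁ id c δind≡δ) ⟩
    map (δ G ∘ suc) (upTo c) ∎
    where
    open ≡-Reasoning
    A = seg O 1 c
    Iind≡I : ∀ {m} → m ≤ c → Iind G A m ≡ I G m
    Iind≡I {m} m≤c = ≤-antisym (Iind≤I G A m) (subst (_≤ Iind G A m) (optimal m m≤n)
      (edgesIn≤Iind G (initial-⊆ O m≤c) (∣initial∣ O m≤n)))
      where m≤n = ≤-trans m≤c c≤n
    δind≡δ : ∀ {i} → i < c → δind G A (suc i) ≡ δ G (suc i)
    δind≡δ {zero}  _   = refl
    δind≡δ {suc i} i<c = cong₂ _∸_ (Iind≡I i<c) (Iind≡I (<⇒≤ i<c))

-- Regular graphs

module _ {n} (G : Graph n) {k} (regular : ∀ v → degree G v ≡ k) where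

  arcs-split-regular : ∀ X Y → arcs G X Y + arcs G X (∁ Y) ≡ ∣ X ∣ * k
  arcs-split-regular X Y = begin
    arcs G X Y + arcs G X (∁ Y)               ≡⟨ arcs-split G X Y ⟩
    ∑[ i < n ] (bit (lookup X i) * degree G i) ≡⟨ sum-cong-≗ (cong (bit (lookup X _) *_) ∘ regular) ⟩
    ∑[ i < n ] (bit (lookup X i) * k)          ≡⟨ sym (*-distribʳ-sum k (bit ∘ lookup X)) ⟩
    ∑[ i < n ] bit (lookup X i) * k            ≡⟨ cong (_* k) (sym (∣∣-∑ X)) ⟩
    ∣ X ∣ * k                                  ∎
    where open ≡-Reasoning

  edgesIn-∁ : ∀ A {a} → ∣ A ∣ ≡ a →
    edgesIn G A + edgesIn G A + (n ∸ a) * k ≡ edgesIn G (∁ A) + edgesIn G (∁ A) + a * k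
  edgesIn-∁ A refl = begin
    edgesIn G A + edgesIn G A + (n ∸ ∣ A ∣) * k
      ≡⟨ cong₂ _+_ (sym (arcs-diagonal G A)) (cong (_* k) (sym (∣∁p∣≡n∸∣p∣ A))) ⟩
    arcs G A A + ∣ ∁ A ∣ * k
      ≡⟨ cong (arcs G A A +_) (sym (arcs-split-regular (∁ A) A)) ⟩
    arcs G A A + (arcs G (∁ A) A + arcs G (∁ A) (∁ A))
      ≡⟨ cong (λ t → arcs G A A + (t + arcs G (∁ A) (∁ A))) (arcs-sym G (∁ A) A) ⟩
    arcs G A A + (arcs G A (∁ A) + arcs G (∁ A) (∁ A))
      ≡⟨ trans (sym (+-assoc (arcs G A A) _ _)) (+-comm (arcs G A A + arcs G A (∁ A)) _) ⟩
    arcs G (∁ A) (∁ A) + (arcs G A A + arcs G A (∁ A))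
      ≡⟨ cong₂ _+_ (arcs-diagonal G (∁ A)) (arcs-split-regular A A) ⟩
    edgesIn G (∁ A) + edgesIn G (∁ A) + ∣ A ∣ * k ∎
    where open ≡-Reasoning

  module _ {O : Order n} (optimal : Optimal G O) where

    reverse-optimal : Optimal G (reverseOrder O)
    reverse-optimal m m≤n = ≤-antisym (edgesIn≤I G {C} ∣C∣≡m) (I-least G λ S ∣S∣≡m →
      m+m≤n+n⇒m≤n (+-cancelʳ-≤ ((n ∸ m) * k) _ _ (begin
        e S + e S + (n ∸ m) * k         ≡⟨ edgesIn-∁ S ∣S∣≡m ⟩
        e (∁ S) + e (∁ S) + m * k       ≤⟨ +-monoˡ-≤ (m * k) (+-mono-≤ (∁S≤A S ∣S∣≡m) (∁S≤A S ∣S∣≡m)) ⟩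
        e A + e A + m * k               ≡⟨ cong (λ t → e A + e A + t * k) (sym n∸[n∸m]≡m) ⟩
        e A + e A + (n ∸ (n ∸ m)) * k   ≡⟨ edgesIn-∁ A ∣A∣≡n∸m ⟩
        e (∁ A) + e (∁ A) + (n ∸ m) * k ≡⟨ cong (λ B → e B + e B + (n ∸ m) * k) (sym C≡∁A) ⟩
        e C + e C + (n ∸ m) * k         ∎)))
      where
      open ≤-Reasoning
      e = edgesIn G
      A = seg O 1 (n ∸ m)
      C = seg (reverseOrder O) 1 m
      n∸[n∸m]≡m = m∸[m∸n]≡n m≤n
      ∣A∣≡n∸m = ∣initial∣ O (m∸n≤m n m)
      C≡∁A : C ≡ ∁ A
      C≡∁A = reverse-initial O m≤n
      ∣C∣≡m : ∣ C ∣ ≡ m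
      ∣C∣≡m = trans (cong ∣_∣ C≡∁A) (trans (∣∁p∣≡n∸∣p∣ A) (trans (cong (n ∸_) ∣A∣≡n∸m) n∸[n∸m]≡m))
      ∁S≤A : ∀ S → ∣ S ∣ ≡ m → e (∁ S) ≤ e A
      ∁S≤A S ∣S∣≡m = subst (e (∁ S) ≤_) (sym (optimal (n ∸ m) (m∸n≤m n m)))
        (edgesIn≤I G {∁ S} (trans (∣∁p∣≡n∸∣p∣ S) (cong (n ∸_) ∣S∣≡m)))

    I-reflect : ∀ {a b} → a + b ≡ n → I G a + I G a + b * k ≡ I G b + I G b + a * k
    I-reflect {a} {b} a+b≡n = begin
      I G a + I G a + b * k             ≡⟨ cong₂ (λ x t → x + x + t * k) (sym (optimal a a≤n)) (sym n∸a≡b) ⟩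
      e A + e A + (n ∸ a) * k           ≡⟨ edgesIn-∁ A (∣initial∣ O a≤n) ⟩
      e (∁ A) + e (∁ A) + a * k         ≡⟨ cong (λ x → x + x + a * k) ∁A-optimal ⟩
      I G b + I G b + a * k             ∎
      where
      open ≡-Reasoning
      e = edgesIn G
      A = seg O 1 a
      a≤n = subst (a ≤_) a+b≡n (m≤m+n a b)
      b≤n = subst (b ≤_) a+b≡n (m≤n+m b a)
      n∸a≡b : n ∸ a ≡ b
      n∸a≡b = trans (cong (_∸ a) (sym a+b≡n)) (m+n∸m≡n a b)
      n∸b≡a : n ∸ b ≡ a
      n∸b≡a = trans (cong (_∸ b) (sym a+b≡n)) (m+n∸n≡m a b)
      ∁A-optimal : e (∁ A) ≡ I G b
      ∁A-optimal = begin
        e (∁ (seg O 1 a))                 ≡⟨ cong (e ∘ ∁ ∘ seg O 1) (sym n∸b≡a) ⟩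
        e (∁ (seg O 1 (n ∸ b)))           ≡⟨ cong e (sym (reverse-initial O b≤n)) ⟩
        e (seg (reverseOrder O) 1 b)      ≡⟨ reverse-optimal b b≤n ⟩
        I G b                             ∎

    I-one : 1 ≤ n → I G 1 ≡ 0
    I-one 1≤n =
      trans (sym (optimal 1 1≤n)) (edgesIn-subsingleton G {seg O 1 1} (initial-one-subsingleton O))

    I-mono : ∀ {m} → suc m ≤ n → I G m ≤ I G (suc m)
    I-mono {m} 1+m≤n = subst₂ _≤_ (optimal m (<⇒≤ 1+m≤n)) (optimal (suc m) 1+m≤n)
      (edgesIn-mono G (initial-⊆ O (n≤1+n m)))

    unitStep⇔ : ∀ {y} → suc (suc y) ≤ n → UnitStep (δ G) (suc y) ⇔ UnitSecondDifference (I G) y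
    unitStep⇔ {y} 2+y≤n rewrite δ-difference G (I-one (≤-trans (s≤s z≤n) 2+y≤n)) y =
      ∸-step⇔ (I-mono (<⇒≤ 2+y≤n)) (I-mono 2+y≤n)

    unitStep-reflect : ∀ {y z} → suc y + suc z ≡ n → UnitStep (δ G) (suc y) → UnitStep (δ G) (suc z)
    unitStep-reflect {y} {z} eq =
      from (unitStep⇔ (bound (trans (+-comm (suc z) (suc y)) eq)))
      ∘ unitSecondDifference-reflect (I G) I-reflect (trans (+-suc y (suc z)) eq)
      ∘ to (unitStep⇔ (bound eq))
      where
      bound : ∀ {y z} → suc y + suc z ≡ n → suc (suc y) ≤ n
      bound {y} {z} eq =
        subst (suc (suc y) ≤_) (trans (sym (+-suc (suc y) z)) eq) (m≤m+n (suc (suc y)) z)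

    cuts-reflect : ∀ {x} → x ∈ cuts n (δ G) → x ≤ n × n ∸ x ∈ cuts n (δ G)
    cuts-reflect x∈ with ∈-cuts⁻ {n} {δ G} x∈
    ... | y , z , refl , eq , ¬step =
      subst (_ ≤_) eq (m≤m+n (suc y) (suc z)) ,
      subst (_∈ cuts n (δ G)) n∸x≡ (∈-cuts⁺ eq′ (¬step ∘ unitStep-reflect eq′))
      where
      eq′ : suc z + suc y ≡ n
      eq′ = trans (+-comm (suc z) (suc y)) eq
      n∸x≡ : suc z ≡ n ∸ suc y
      n∸x≡ = trans (sym (m+n∸m≡n (suc y) (suc z))) (cong (_∸ suc y) eq)

    regular-partition : RegularPartition G (standardMonotonicPartition G O)
    regular-partition F L F-first L-last = begin
      δseq G F
        ≡⟨ cong (δseq G) (head-standardMonotonicPartition G O F-first) ⟩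
      δseq G (seg O 1 c)
        ≡⟨ δseq-initial G {O} optimal c≤n ⟩
      map (δ G ∘ suc) (upTo c)
        ≡⟨ cong (map (δ G ∘ suc) ∘ upTo) c≡n∸l ⟩
      map (δ G ∘ suc) (upTo (n ∸ l))
        ≡⟨ sym (δseq-initial G {reverseOrder O} reverse-optimal (m∸n≤m n l)) ⟩
      δseq G (seg (reverseOrder O) 1 (n ∸ l))
        ≡⟨ cong (δseq G) (sym (final≡reverse-initial O l≤n)) ⟩
      δseq G (seg O (suc l) n)
        ≡⟨ cong (δseq G) (sym (last-standardMonotonicPartition G O L-last)) ⟩
      δseq G L ∎
      where
      open ≡-Reasoning
      cs = cuts n (δ G)
      c = fromMaybe n (head cs)
      l = lastOr 0 cs
      c+l≡n : c + l ≡ n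
      c+l≡n = first+last≡ cs (cuts-sorted n (δ G)) cuts-reflect
      c≤n = subst (c ≤_) c+l≡n (m≤m+n c l)
      l≤n = subst (l ≤_) c+l≡n (m≤n+m l c)
      c≡n∸l = trans (sym (m+n∸n≡m c l)) (cong (_∸ l) c+l≡n)

corollary9 : ∀ {n : ℕ} (G : Graph n) (O : Order n) →
    IsRegular G → Optimal G O →
    Optimal G (reverseOrder O) × RegularPartition G (standardMonotonicPartition G O)
corollary9 G O (k , regular) optimal =
  reverse-optimal G regular {O} optimal , regular-partition G regular {O} optimal
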